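{- Let $\Xi = \{x_1,\dots,x_n\}$ be a set of unknowns, let $\Sigma \subset \{1,2,3,\dots\}$ be an alphabet of positive integers, and let $E : u = v$ be a word equation with $u, v \in \Xi^*$. A morphism $h : \Xi^* \to \Sigma^*$ of length type $L$ is a solution of $E$ if and only if $$\sum_{x \in \Xi} q_{E,x,L}(X)\, P_{h(x)}(X) = 0 .$$
   Context: For a word $w = a_0\cdots a_{m-1}$ over $\Sigma$, $P_w(X) = \sum_{i=0}^{m-1} a_i X^i \in \mathbb{Z}[X]$. A morphism $h:\Xi^*\to\Sigma^*$ is a solution of $u=v$ if $h(u)=h(v)$. The length type of $h$ is $L = (|h(x_1)|,\dots,|h(x_n)|) \in \mathbb{N}_0^n$, and $\ell_L : \Xi^* \to \mathbb{N}_0$ is the monoid morphism with $\ell_L(x_i) = L_i$ (so $\ell_L(w) = |h(w)|$). For an equation $E : y_1 \cdots y_k = z_1 \cdots z_l$ with $y_i, z_i \in \Xi$, an unknown $x \in \Xi$ and $L \in \mathbb{N}_0^n$, $$q_{E,x,L}(X) = \sum_{i:\, y_i = x} X^{\ell_L(y_1\cdots y_{i-1})} - \sum_{i:\, z_i = x} X^{\ell_L(z_1 \cdots z_{i-1})}.$$ -}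

module Defs where

open import Data.Nat using (ℕ; zero; suc)
open import Data.Integer using (ℤ; +_; -_) renaming (_+_ to _+ℤ_; _*_ to _*ℤ_)
open import Data.Fin using (Fin)
open import Data.Fin.Properties using () renaming (_≟_ to _≟F_)
open import Data.List using (List; []; _∷_; map; length; replicate)
open import Data.List.Relation.Unary.All using (All)
open import Relation.Binary.PropositionalEquality using (_≡_)
open import Relation.Nullary using (yes; no)

-- Polynomials in ℤ[X] as coefficient lists, lowest degree first:
-- [c₀, c₁, …] represents c₀ + c₁ X + c₂ X² + …
Poly : Set
Poly = List ℤ

IsZeroPoly : Poly → Set
IsZeroPoly p = All (_≡ + 0) p

infixl 6 _⊕_
_⊕_ : Poly → Poly → Poly
[] ⊕ q = q
p ⊕ [] = p
(a ∷ p) ⊕ (b ∷ q) = (a +ℤ b) ∷ (p ⊕ q)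

neg : Poly → Poly
neg = map -_

scale : ℤ → Poly → Poly
scale c = map (c *ℤ_)

infixl 7 _⊗_
_⊗_ : Poly → Poly → Poly
[] ⊗ q = []
(a ∷ p) ⊗ q = scale a q ⊕ (+ 0 ∷ (p ⊗ q))

monomial : ℕ → Poly
monomial k = replicate k (+ 0) Data.List.++ (+ 1 ∷ [])

-- P_w(X) = Σ a_i X^i for a word w = a₀ ⋯ a_{m-1} over ℕ
P : List ℕ → Poly
P w = map +_ w

Word : ℕ → Set
Word n = List (Fin n)

hom : ∀ {n} → (Fin n → List ℕ) → Word n → List ℕ
hom h [] = []
hom h (x ∷ w) = h x Data.List.++ hom h w

ℓ : ∀ {n} → (Fin n → ℕ) → Word n → ℕ
ℓ L [] = 0
ℓ L (x ∷ w) = L x Data.Nat.+ ℓ L w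

-- Σ_{i : y_i = x} X^{ℓ_L(y₁⋯y_{i-1})}, with the prefix length accumulated in `off`
occ : ∀ {n} → (Fin n → ℕ) → Fin n → ℕ → Word n → Poly
occ L x off [] = []
occ L x off (y ∷ w) with y ≟F x
... | yes _ = monomial off ⊕ occ L x (off Data.Nat.+ L y) w
... | no  _ = occ L x (off Data.Nat.+ L y) w

q : ∀ {n} → Word n → Word n → Fin n → (Fin n → ℕ) → Poly
q u v x L = occ L x 0 u ⊕ neg (occ L x 0 v)

sumPoly : ∀ {n} → (Fin n → Poly) → Poly
sumPoly {zero} f = []
sumPoly {suc n} f = f Fin.zero ⊕ sumPoly (λ i → f (Fin.suc i))

-- An occurrence of x in u after the prefix y₁⋯y_{i-1} contributes
-- X^{ℓ_L(y₁⋯y_{i-1})} P_{h(x)}, the polynomial of the block h(x) at its position inside h(u).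
-- Summing over all occurrences of all unknowns gives Σ_x q_{E,x,L} P_{h(x)} = P_{h(u)} − P_{h(v)}.
-- As all letters are nonzero, a word is determined by the coefficients of its polynomial,
-- so this vanishes iff h(u) = h(v).
module Submission where

open import Defs
open import Data.Nat using (ℕ; zero; suc; _≤_; s≤s) renaming (_+_ to _+ℕ_)
open import Data.Integer using (ℤ; +_; -_) renaming (_+_ to _+ℤ_; _*_ to _*ℤ_)
import Data.Integer.Properties as ℤ
open import Algebra.Properties.CommutativeSemigroup ℤ.+-commutativeSemigroup using (interchange)
open import Data.Fin using (Fin) renaming (zero to fzero; suc to fsuc)
open import Data.Fin.Properties using () renaming (_≟_ to _≟F_)
open import Data.List using (List; []; _∷_; _++_; length; replicate)
open import Data.List.Properties using (map-++; length-map)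
open import Data.List.Relation.Unary.All as All using (All; []; _∷_)
open import Data.List.Relation.Unary.All.Properties using (++⁺)
open import Function.Bundles using (_⇔_; mk⇔)
open import Function.Properties.Equivalence using () renaming (trans to ⇔-trans; sym to ⇔-sym)
open import Relation.Binary.Bundles using (Setoid)
open import Relation.Binary.PropositionalEquality using (_≡_; refl; sym; trans; cong; cong₂)
open import Relation.Nullary using (yes; no)

coeff : Poly → ℕ → ℤ
coeff []      i       = + 0
coeff (a ∷ p) zero    = a
coeff (a ∷ p) (suc i) = coeff p i

-- Coefficient lists differing by trailing zeros denote the same polynomial.
infix 4 _≈_
record _≈_ (p q : Poly) : Set where
  constructor coeffwise
  field coeff-≡ : ∀ i → coeff p i ≡ coeff q i
open _≈_

≈-setoid : Setoid _ _
≈-setoid = record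
  { Carrier       = Poly
  ; _≈_           = _≈_
  ; isEquivalence = record
    { refl  = coeffwise λ i → refl
    ; sym   = λ p≈q → coeffwise λ i → sym (coeff-≡ p≈q i)
    ; trans = λ p≈q q≈r → coeffwise λ i → trans (coeff-≡ p≈q i) (coeff-≡ q≈r i)
    }
  }

open Setoid ≈-setoid using ()
  renaming (refl to ≈-refl; reflexive to ≈-reflexive; sym to ≈-sym; trans to ≈-trans)
open import Relation.Binary.Reasoning.Setoid ≈-setoid

shift : ℕ → Poly → Poly
shift k p = replicate k (+ 0) ++ p

coeff-⊕ : ∀ p q i → coeff (p ⊕ q) i ≡ coeff p i +ℤ coeff q i
coeff-⊕ []      q       i       = sym (ℤ.+-identityˡ _)
coeff-⊕ (a ∷ p) []      i       = sym (ℤ.+-identityʳ _)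
coeff-⊕ (a ∷ p) (b ∷ q) zero    = refl
coeff-⊕ (a ∷ p) (b ∷ q) (suc i) = coeff-⊕ p q i

coeff-neg : ∀ p i → coeff (neg p) i ≡ - coeff p i
coeff-neg []      i       = refl
coeff-neg (a ∷ p) zero    = refl
coeff-neg (a ∷ p) (suc i) = coeff-neg p i

coeff-scale : ∀ c p i → coeff (scale c p) i ≡ c *ℤ coeff p i
coeff-scale c []      i       = sym (ℤ.*-zeroʳ c)
coeff-scale c (a ∷ p) zero    = refl
coeff-scale c (a ∷ p) (suc i) = coeff-scale c p i

coeff-⊕⊕ : ∀ p q r s i →
  coeff ((p ⊕ q) ⊕ (r ⊕ s)) i ≡ (coeff p i +ℤ coeff q i) +ℤ (coeff r i +ℤ coeff s i)
coeff-⊕⊕ p q r s i =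
  trans (coeff-⊕ (p ⊕ q) (r ⊕ s) i) (cong₂ _+ℤ_ (coeff-⊕ p q i) (coeff-⊕ r s i))

∷-cong : ∀ {a p q} → p ≈ q → a ∷ p ≈ a ∷ q
coeff-≡ (∷-cong p≈q) zero    = refl
coeff-≡ (∷-cong p≈q) (suc i) = coeff-≡ p≈q i

⊕-cong : ∀ {p p′ q q′} → p ≈ p′ → q ≈ q′ → p ⊕ q ≈ p′ ⊕ q′
coeff-≡ (⊕-cong {p} {p′} {q} {q′} p≈p′ q≈q′) i =
  trans (coeff-⊕ p q i)
        (trans (cong₂ _+ℤ_ (coeff-≡ p≈p′ i) (coeff-≡ q≈q′ i)) (sym (coeff-⊕ p′ q′ i)))

neg-cong : ∀ {p q} → p ≈ q → neg p ≈ neg q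
coeff-≡ (neg-cong {p} {q} p≈q) i =
  trans (coeff-neg p i) (trans (cong -_ (coeff-≡ p≈q i)) (sym (coeff-neg q i)))

⊕-identityʳ : ∀ p → p ⊕ [] ≡ p
⊕-identityʳ []      = refl
⊕-identityʳ (a ∷ p) = refl

⊕-interchange : ∀ p q r s → (p ⊕ q) ⊕ (r ⊕ s) ≈ (p ⊕ r) ⊕ (q ⊕ s)
coeff-≡ (⊕-interchange p q r s) i =
  trans (coeff-⊕⊕ p q r s i)
        (trans (interchange (coeff p i) (coeff q i) (coeff r i) (coeff s i))
               (sym (coeff-⊕⊕ p r q s i)))

⊕-inverseʳ : ∀ p → p ⊕ neg p ≈ []
coeff-≡ (⊕-inverseʳ p) i =
  trans (coeff-⊕ p (neg p) i)
        (trans (cong (coeff p i +ℤ_) (coeff-neg p i)) (ℤ.+-inverseʳ (coeff p i)))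

neg-distrib-⊕ : ∀ p q → neg (p ⊕ q) ≡ neg p ⊕ neg q
neg-distrib-⊕ []      q       = refl
neg-distrib-⊕ (a ∷ p) []      = refl
neg-distrib-⊕ (a ∷ p) (b ∷ q) = cong₂ _∷_ (ℤ.neg-distrib-+ a b) (neg-distrib-⊕ p q)

scale-distribʳ : ∀ a b p → scale (a +ℤ b) p ≡ scale a p ⊕ scale b p
scale-distribʳ a b []      = refl
scale-distribʳ a b (c ∷ p) = cong₂ _∷_ (ℤ.*-distribʳ-+ c a b) (scale-distribʳ a b p)

scale-neg : ∀ a p → scale (- a) p ≡ neg (scale a p)
scale-neg a []      = refl
scale-neg a (c ∷ p) = cong₂ _∷_ (sym (ℤ.neg-distribˡ-* a c)) (scale-neg a p)

scale-identity : ∀ p → scale (+ 1) p ≡ p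
scale-identity []      = refl
scale-identity (c ∷ p) = cong₂ _∷_ (ℤ.*-identityˡ c) (scale-identity p)

scale-zero : ∀ p → scale (+ 0) p ≈ []
scale-zero p = coeffwise (coeff-scale (+ 0) p)

shift-[] : ∀ k → shift k [] ≈ []
coeff-≡ (shift-[] zero)    i       = refl
coeff-≡ (shift-[] (suc k)) zero    = refl
coeff-≡ (shift-[] (suc k)) (suc i) = coeff-≡ (shift-[] k) i

++≈⊕-shift : ∀ p q → p ++ q ≈ p ⊕ shift (length p) q
coeff-≡ (++≈⊕-shift []      q) i       = refl
coeff-≡ (++≈⊕-shift (a ∷ p) q) zero    = sym (ℤ.+-identityʳ a)
coeff-≡ (++≈⊕-shift (a ∷ p) q) (suc i) = coeff-≡ (++≈⊕-shift p q) i

shift-++ : ∀ k p q → shift k (p ++ q) ≈ shift k p ⊕ shift (k +ℕ length p) q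
shift-++ zero    p q = ++≈⊕-shift p q
shift-++ (suc k) p q = coeffwise λ where
  zero    → refl
  (suc i) → coeff-≡ (shift-++ k p q) i

⊗-distribʳ-⊕ : ∀ p p′ r → (p ⊕ p′) ⊗ r ≈ p ⊗ r ⊕ p′ ⊗ r
⊗-distribʳ-⊕ []      p′       r = ≈-refl
⊗-distribʳ-⊕ (a ∷ p) []       r = ≈-reflexive (sym (⊕-identityʳ ((a ∷ p) ⊗ r)))
⊗-distribʳ-⊕ (a ∷ p) (b ∷ p′) r = begin
  scale (a +ℤ b) r ⊕ (+ 0 ∷ (p ⊕ p′) ⊗ r)
    ≈⟨ ⊕-cong (≈-reflexive (scale-distribʳ a b r)) (∷-cong (⊗-distribʳ-⊕ p p′ r)) ⟩
  (scale a r ⊕ scale b r) ⊕ ((+ 0 ∷ p ⊗ r) ⊕ (+ 0 ∷ p′ ⊗ r))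
    ≈⟨ ⊕-interchange (scale a r) (scale b r) (+ 0 ∷ p ⊗ r) (+ 0 ∷ p′ ⊗ r) ⟩
  (a ∷ p) ⊗ r ⊕ (b ∷ p′) ⊗ r ∎

neg-⊗ : ∀ p r → neg p ⊗ r ≈ neg (p ⊗ r)
neg-⊗ []      r = ≈-refl
neg-⊗ (a ∷ p) r = begin
  scale (- a) r ⊕ (+ 0 ∷ neg p ⊗ r)
    ≈⟨ ⊕-cong (≈-reflexive (scale-neg a r)) (∷-cong (neg-⊗ p r)) ⟩
  neg (scale a r) ⊕ neg (+ 0 ∷ p ⊗ r)
    ≡⟨ neg-distrib-⊕ (scale a r) (+ 0 ∷ p ⊗ r) ⟨
  neg ((a ∷ p) ⊗ r) ∎

monomial-⊗ : ∀ k r → monomial k ⊗ r ≈ shift k r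
monomial-⊗ zero r = begin
  scale (+ 1) r ⊕ shift 1 []
    ≈⟨ ⊕-cong (≈-reflexive (scale-identity r)) (shift-[] 1) ⟩
  r ⊕ []
    ≡⟨ ⊕-identityʳ r ⟩
  r ∎
monomial-⊗ (suc k) r = begin
  scale (+ 0) r ⊕ (+ 0 ∷ monomial k ⊗ r)
    ≈⟨ ⊕-cong (scale-zero r) (∷-cong (monomial-⊗ k r)) ⟩
  shift (suc k) r ∎

sumPoly-cong : ∀ {n} {f g : Fin n → Poly} → (∀ x → f x ≈ g x) → sumPoly f ≈ sumPoly g
sumPoly-cong {zero}  f≈g = ≈-refl
sumPoly-cong {suc n} f≈g = ⊕-cong (f≈g fzero) (sumPoly-cong (λ x → f≈g (fsuc x)))

sumPoly-[] : ∀ {n} → sumPoly {n} (λ _ → []) ≡ []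
sumPoly-[] {zero}  = refl
sumPoly-[] {suc n} = sumPoly-[] {n}

sumPoly-⊕ : ∀ {n} (f g : Fin n → Poly) → sumPoly (λ x → f x ⊕ g x) ≈ sumPoly f ⊕ sumPoly g
sumPoly-⊕ {zero}  f g = ≈-refl
sumPoly-⊕ {suc n} f g = begin
  (f fzero ⊕ g fzero) ⊕ sumPoly (λ x → f (fsuc x) ⊕ g (fsuc x))
    ≈⟨ ⊕-cong (≈-refl {f fzero ⊕ g fzero}) (sumPoly-⊕ f′ g′) ⟩
  (f fzero ⊕ g fzero) ⊕ (sumPoly f′ ⊕ sumPoly g′)
    ≈⟨ ⊕-interchange (f fzero) (g fzero) (sumPoly f′) (sumPoly g′) ⟩
  sumPoly f ⊕ sumPoly g ∎
  where
  f′ g′ : Fin n → Poly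
  f′ x = f (fsuc x)
  g′ x = g (fsuc x)

sumPoly-neg : ∀ {n} (f : Fin n → Poly) → sumPoly (λ x → neg (f x)) ≡ neg (sumPoly f)
sumPoly-neg {zero}  f = refl
sumPoly-neg {suc n} f =
  trans (cong (neg (f fzero) ⊕_) (sumPoly-neg (λ x → f (fsuc x))))
        (sym (neg-distrib-⊕ (f fzero) (sumPoly (λ x → f (fsuc x)))))

single : ∀ {n} → Fin n → Poly → Fin n → Poly
single y p x with y ≟F x
... | yes _ = p
... | no  _ = []

single-suc : ∀ {n} (y : Fin n) p x → single (fsuc y) p (fsuc x) ≡ single y p x
single-suc y p x with y ≟F x
... | yes _ = refl
... | no  _ = refl

sumPoly-single : ∀ {n} (y : Fin n) p → sumPoly (single y p) ≈ p
sumPoly-single {suc n} fzero    p =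
  ≈-reflexive (trans (cong (p ⊕_) (sumPoly-[] {n})) (⊕-identityʳ p))
sumPoly-single {suc n} (fsuc y) p = begin
  sumPoly (λ x → single (fsuc y) p (fsuc x))
    ≈⟨ sumPoly-cong (λ x → ≈-reflexive (single-suc y p x)) ⟩
  sumPoly (single y p)
    ≈⟨ sumPoly-single y p ⟩
  p ∎

module _ {n} (h : Fin n → List ℕ) (L : Fin n → ℕ) (L≡|h| : ∀ x → L x ≡ length (h x)) where

  occ-∷-⊗ : ∀ off y w x →
    occ L x off (y ∷ w) ⊗ P (h x)
      ≈ single y (shift off (P (h y))) x ⊕ occ L x (off +ℕ L y) w ⊗ P (h x)
  occ-∷-⊗ off y w x with y ≟F x
  ... | yes refl = ≈-trans (⊗-distribʳ-⊕ (monomial off) _ (P (h y)))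
                           (⊕-cong (monomial-⊗ off _) ≈-refl)
  ... | no  _    = ≈-refl

  sumPoly-occ-⊗ : ∀ w off →
    sumPoly (λ x → occ L x off w ⊗ P (h x)) ≈ shift off (P (hom h w))
  sumPoly-occ-⊗ [] off = ≈-trans (≈-reflexive (sumPoly-[] {n})) (≈-sym (shift-[] off))
  sumPoly-occ-⊗ (y ∷ w) off = begin
    sumPoly (λ x → occ L x off (y ∷ w) ⊗ P (h x))
      ≈⟨ sumPoly-cong (occ-∷-⊗ off y w) ⟩
    sumPoly (λ x → single y (shift off (P (h y))) x ⊕ occ L x off′ w ⊗ P (h x))
      ≈⟨ sumPoly-⊕ (single y (shift off (P (h y)))) (λ x → occ L x off′ w ⊗ P (h x)) ⟩
    sumPoly (single y (shift off (P (h y)))) ⊕ sumPoly (λ x → occ L x off′ w ⊗ P (h x))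
      ≈⟨ ⊕-cong (sumPoly-single y _) (sumPoly-occ-⊗ w off′) ⟩
    shift off (P (h y)) ⊕ shift off′ (P (hom h w))
      ≡⟨ cong (λ k → shift off (P (h y)) ⊕ shift (off +ℕ k) (P (hom h w))) L≡|P| ⟩
    shift off (P (h y)) ⊕ shift (off +ℕ length (P (h y))) (P (hom h w))
      ≈⟨ shift-++ off (P (h y)) (P (hom h w)) ⟨
    shift off (P (h y) ++ P (hom h w))
      ≡⟨ cong (shift off) (map-++ +_ (h y) (hom h w)) ⟨
    shift off (P (hom h (y ∷ w))) ∎
    where
    off′ = off +ℕ L y
    L≡|P| : L y ≡ length (P (h y))
    L≡|P| = trans (L≡|h| y) (sym (length-map +_ (h y)))

  sumPoly-q-⊗ : ∀ u v → sumPoly (λ x → q u v x L ⊗ P (h x)) ≈ P (hom h u) ⊕ neg (P (hom h v))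
  sumPoly-q-⊗ u v = begin
    sumPoly (λ x → (occ L x 0 u ⊕ neg (occ L x 0 v)) ⊗ P (h x))
      ≈⟨ sumPoly-cong (λ x → ≈-trans (⊗-distribʳ-⊕ (occ L x 0 u) _ (P (h x)))
                                     (⊕-cong (≈-refl {U x}) (neg-⊗ (occ L x 0 v) (P (h x))))) ⟩
    sumPoly (λ x → U x ⊕ neg (V x))
      ≈⟨ sumPoly-⊕ U (λ x → neg (V x)) ⟩
    sumPoly U ⊕ sumPoly (λ x → neg (V x))
      ≡⟨ cong (sumPoly U ⊕_) (sumPoly-neg V) ⟩
    sumPoly U ⊕ neg (sumPoly V)
      ≈⟨ ⊕-cong (sumPoly-occ-⊗ u 0) (neg-cong (sumPoly-occ-⊗ v 0)) ⟩
    P (hom h u) ⊕ neg (P (hom h v)) ∎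
    where
    U V : Fin n → Poly
    U x = occ L x 0 u ⊗ P (h x)
    V x = occ L x 0 v ⊗ P (h x)

IsZeroPoly⇔≈[] : ∀ p → IsZeroPoly p ⇔ p ≈ []
IsZeroPoly⇔≈[] p = mk⇔ (to p) (from p)
  where
  to : ∀ p → IsZeroPoly p → p ≈ []
  coeff-≡ (to []      [])        i       = refl
  coeff-≡ (to (a ∷ p) (a≡0 ∷ z)) zero    = a≡0
  coeff-≡ (to (a ∷ p) (a≡0 ∷ z)) (suc i) = coeff-≡ (to p z) i
  from : ∀ p → p ≈ [] → IsZeroPoly p
  from []      p≈[] = []
  from (a ∷ p) p≈[] = coeff-≡ p≈[] zero ∷ from p (coeffwise λ i → coeff-≡ p≈[] (suc i))

≈[]-cong : ∀ {p q} → p ≈ q → (p ≈ []) ⇔ (q ≈ [])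
≈[]-cong p≈q = mk⇔ (≈-trans (≈-sym p≈q)) (≈-trans p≈q)

≈⇔⊕-neg≈[] : ∀ p q → (p ≈ q) ⇔ (p ⊕ neg q ≈ [])
≈⇔⊕-neg≈[] p q = mk⇔ (λ p≈q → ≈-trans (⊕-cong p≈q ≈-refl) (⊕-inverseʳ q)) from
  where
  from : p ⊕ neg q ≈ [] → p ≈ q
  coeff-≡ (from p-q≈[]) i = ℤ.i-j≡0⇒i≡j (coeff p i) (coeff q i) (trans coeff-p-q (coeff-≡ p-q≈[] i))
    where
    coeff-p-q : coeff p i +ℤ - coeff q i ≡ coeff (p ⊕ neg q) i
    coeff-p-q = sym (trans (coeff-⊕ p (neg q) i) (cong (coeff p i +ℤ_) (coeff-neg q i)))

P-injective : ∀ {a b} → All (1 ≤_) a → All (1 ≤_) b → P a ≈ P b → a ≡ b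
P-injective []          []          Pa≈Pb = refl
P-injective []          (s≤s _ ∷ _) Pa≈Pb with coeff-≡ Pa≈Pb zero
... | ()
P-injective (s≤s _ ∷ _) []          Pa≈Pb with coeff-≡ Pa≈Pb zero
... | ()
P-injective (_ ∷ a⁺)    (_ ∷ b⁺)    Pa≈Pb =
  cong₂ _∷_ (ℤ.+-injective (coeff-≡ Pa≈Pb zero))
            (P-injective a⁺ b⁺ (coeffwise λ i → coeff-≡ Pa≈Pb (suc i)))

≡⇔P≈ : ∀ {a b} → All (1 ≤_) a → All (1 ≤_) b → (a ≡ b) ⇔ (P a ≈ P b)
≡⇔P≈ a⁺ b⁺ = mk⇔ (λ a≡b → ≈-reflexive (cong P a≡b)) (P-injective a⁺ b⁺)

All-hom : ∀ {n} {A : ℕ → Set} (h : Fin n → List ℕ) →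
          (∀ x → All A (h x)) → ∀ w → All A (hom h w)
All-hom h hA []      = []
All-hom h hA (x ∷ w) = ++⁺ (hA x) (All-hom h hA w)

theorem4 : (n : ℕ) (Σ : ℕ → Set) → (∀ a → Σ a → 1 ≤ a) →
           (u v : Word n) (h : Fin n → List ℕ) (L : Fin n → ℕ) →
           (∀ x → All Σ (h x)) → (∀ x → L x ≡ length (h x)) →
           (hom h u ≡ hom h v) ⇔ IsZeroPoly (sumPoly (λ x → q u v x L ⊗ P (h x)))
theorem4 n Σ Σ⁺ u v h L hΣ L≡|h| =
  ⇔-trans (≡⇔P≈ (nonzero u) (nonzero v))
  (⇔-trans (≈⇔⊕-neg≈[] (P (hom h u)) (P (hom h v)))
  (⇔-trans (≈[]-cong (≈-sym (sumPoly-q-⊗ h L L≡|h| u v)))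
           (⇔-sym (IsZeroPoly⇔≈[] _))))
  where
  nonzero : ∀ w → All (1 ≤_) (hom h w)
  nonzero = All-hom h (λ x → All.map (Σ⁺ _) (hΣ x))
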